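{- Let $\varphi\in\mathbb{Z}[x_0,x_1,x_2]$ be a homogeneous quadratic form, $\Phi$ the symmetric bilinear form with $\Phi(\underline{x},\underline{x})=2\varphi(\underline{x})$, and $\psi(\underline{x},\underline{y})=\Phi(\underline{x},\underline{y})\underline{x}-\varphi(\underline{x})\underline{y}$. Suppose that $\underline{y}_{ -1},\underline{y}_0,\underline{y}_1\in\mathbb{Z}^3$ satisfy $\varphi(\underline{y}_i)=1$ for $i=-1,0,1$. Extend this triple to a sequence $(\underline{y}_i)_{i\ge-1}$ in $\mathbb{Z}^3$ by $\underline{y}_{i+1}=\psi(\underline{y}_i,\underline{y}_{i-2})$ for each $i\ge1$, and define $t_i=\Phi(\underline{y}_{i+1},\underline{y}_i)\in\mathbb{Z}$ for each $i\ge-1$. Then, for every integer $i\ge1$: (a) $\varphi(\underline{y}_{i-2})=1$; (b) $\det(\underline{y}_i,\underline{y}_{i-1},\underline{y}_{i-2})=(-1)^{i-1}\det(\underline{y}_1,\underline{y}_0,\underline{y}_{ -1})$; (c) $t_i=\Phi(\underline{y}_{i+1},\underline{y}_i)=\Phi(\underline{y}_i,\underline{y}_{i-2})$; (d) $\underline{y}_{i+1}=t_i\underline{y}_i-\underline{y}_{i-2}$; (e) $t_{i+1}=t_it_{i-1}-t_{i-2}$. In particular $t_{ -1}=\Phi(\underline{y}_0,\underline{y}_{ -1})$, $t_0=\Phi(\underline{y}_1,\underline{y}_0)$ and $t_1=\Phi(\underline{y}_1,\underline{y}_{ -1})$. -}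

module Defs where

open import Data.Nat using (ℕ; zero; suc)
open import Data.Integer using (ℤ; _+_; _-_; _*_; -_)

record V3 : Set where
  constructor ⟨_,_,_⟩
  field
    v0 v1 v2 : ℤ
open V3 public

_+ᵥ_ : V3 → V3 → V3
⟨ a , b , c ⟩ +ᵥ ⟨ d , e , f ⟩ = ⟨ a + d , b + e , c + f ⟩

_-ᵥ_ : V3 → V3 → V3
⟨ a , b , c ⟩ -ᵥ ⟨ d , e , f ⟩ = ⟨ a - d , b - e , c - f ⟩

_·ᵥ_ : ℤ → V3 → V3
k ·ᵥ ⟨ a , b , c ⟩ = ⟨ k * a , k * b , k * c ⟩

-- A homogeneous quadratic form in ℤ[x0,x1,x2], given by its six coefficients:
-- φ(x) = c00 x0² + c11 x1² + c22 x2² + c01 x0 x1 + c02 x0 x2 + c12 x1 x2.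
record QForm : Set where
  constructor qform
  field
    c00 c11 c22 c01 c02 c12 : ℤ
open QForm public

φ : QForm → V3 → ℤ
φ q ⟨ x0 , x1 , x2 ⟩ =
  c00 q * (x0 * x0) + c11 q * (x1 * x1) + c22 q * (x2 * x2)
  + c01 q * (x0 * x1) + c02 q * (x0 * x2) + c12 q * (x1 * x2)

Φ : QForm → V3 → V3 → ℤ
Φ q ⟨ x0 , x1 , x2 ⟩ ⟨ y0 , y1 , y2 ⟩ =
  (c00 q + c00 q) * (x0 * y0) + (c11 q + c11 q) * (x1 * y1)
  + (c22 q + c22 q) * (x2 * y2)
  + c01 q * (x0 * y1 + x1 * y0) + c02 q * (x0 * y2 + x2 * y0)
  + c12 q * (x1 * y2 + x2 * y1)

ψ : QForm → V3 → V3 → V3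
ψ q x y = (Φ q x y ·ᵥ x) -ᵥ (φ q x ·ᵥ y)

det3 : V3 → V3 → V3 → ℤ
det3 ⟨ a0 , a1 , a2 ⟩ ⟨ b0 , b1 , b2 ⟩ ⟨ c0 , c1 , c2 ⟩ =
  a0 * (b1 * c2 - b2 * c1) - b0 * (a1 * c2 - a2 * c1) + c0 * (a1 * b2 - a2 * b1)

-- The sequence (y_i)_{i ≥ -1}, shifted: Y q a b c n = y_{n-1},
-- with y_{-1} = a, y_0 = b, y_1 = c and y_{i+1} = ψ(y_i, y_{i-2}) for i ≥ 1.
Y : QForm → V3 → V3 → V3 → ℕ → V3
Y q a b c zero = a
Y q a b c (suc zero) = b
Y q a b c (suc (suc zero)) = c
Y q a b c (suc (suc (suc n))) = ψ q (Y q a b c (suc (suc n))) (Y q a b c n)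

-- Shifted t: T q a b c n = t_{n-1} = Φ(y_n, y_{n-1}).
T : QForm → V3 → V3 → V3 → ℕ → ℤ
T q a b c n = Φ q (Y q a b c (suc n)) (Y q a b c n)

{-# OPTIONS --safe #-}
module Submission where

open import Defs
open import Data.Nat using (ℕ; zero; suc)
open import Data.Integer using (ℤ; _+_; _-_; _*_; -_; _^_; -1ℤ; 1ℤ)
open import Data.Integer.Properties using (*-identityˡ; *-assoc)
open import Data.Integer.Solver using (module +-*-Solver)
open import Data.Integer.Tactic.RingSolver using (solve-∀)
open import Data.Product using (_×_; _,_)
open import Relation.Binary.PropositionalEquality
  using (_≡_; refl; sym; trans; cong; cong₂; module ≡-Reasoning)

-- ψ(x,y) = Φ(x,y) x − φ(x) y satisfies φ(ψ(x,y)) = φ(x)² φ(y), Φ(ψ(x,y),x) = φ(x) Φ(x,y)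
-- and det(ψ(x,y),x,z) = −φ(x) det(x,z,y).  So φ = 1 propagates along the sequence, and
-- then ψ(y_i, y_{i-2}) = t_i y_i − y_{i-2} with t_i = Φ(y_i, y_{i-2}): each step flips the
-- sign of the determinant, and pairing the recursion with y_{i-1} gives t_{i+1} = t_i t_{i-1} − t_{i-2}.

·ᵥ-identityˡ : ∀ x → 1ℤ ·ᵥ x ≡ x
·ᵥ-identityˡ ⟨ x0 , x1 , x2 ⟩
  rewrite *-identityˡ x0 | *-identityˡ x1 | *-identityˡ x2 = refl

module _ where
  open +-*-Solver

  φ′ : ∀ {n} (c00 c11 c22 c01 c02 c12 x0 x1 x2 : Polynomial n) → Polynomial n
  φ′ c00 c11 c22 c01 c02 c12 x0 x1 x2 =
    c00 :* (x0 :* x0) :+ c11 :* (x1 :* x1) :+ c22 :* (x2 :* x2)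
    :+ c01 :* (x0 :* x1) :+ c02 :* (x0 :* x2) :+ c12 :* (x1 :* x2)

  Φ′ : ∀ {n} (c00 c11 c22 c01 c02 c12 x0 x1 x2 y0 y1 y2 : Polynomial n) → Polynomial n
  Φ′ c00 c11 c22 c01 c02 c12 x0 x1 x2 y0 y1 y2 =
    (c00 :+ c00) :* (x0 :* y0) :+ (c11 :+ c11) :* (x1 :* y1)
    :+ (c22 :+ c22) :* (x2 :* y2)
    :+ c01 :* (x0 :* y1 :+ x1 :* y0) :+ c02 :* (x0 :* y2 :+ x2 :* y0)
    :+ c12 :* (x1 :* y2 :+ x2 :* y1)

  det3′ : ∀ {n} (a0 a1 a2 b0 b1 b2 c0 c1 c2 : Polynomial n) → Polynomial n
  det3′ a0 a1 a2 b0 b1 b2 c0 c1 c2 =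
    a0 :* (b1 :* c2 :- b2 :* c1) :- b0 :* (a1 :* c2 :- a2 :* c1)
    :+ c0 :* (a1 :* b2 :- a2 :* b1)

  Φ-sym : ∀ q x y → Φ q x y ≡ Φ q y x
  Φ-sym (qform c00 c11 c22 c01 c02 c12) ⟨ x0 , x1 , x2 ⟩ ⟨ y0 , y1 , y2 ⟩ =
    solve 12 (λ c00 c11 c22 c01 c02 c12 x0 x1 x2 y0 y1 y2 →
      Φ′ c00 c11 c22 c01 c02 c12 x0 x1 x2 y0 y1 y2
      := Φ′ c00 c11 c22 c01 c02 c12 y0 y1 y2 x0 x1 x2)
      refl c00 c11 c22 c01 c02 c12 x0 x1 x2 y0 y1 y2

  Φ-diag : ∀ q x → Φ q x x ≡ φ q x + φ q x
  Φ-diag (qform c00 c11 c22 c01 c02 c12) ⟨ x0 , x1 , x2 ⟩ =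
    solve 9 (λ c00 c11 c22 c01 c02 c12 x0 x1 x2 →
      Φ′ c00 c11 c22 c01 c02 c12 x0 x1 x2 x0 x1 x2
      := φ′ c00 c11 c22 c01 c02 c12 x0 x1 x2 :+ φ′ c00 c11 c22 c01 c02 c12 x0 x1 x2)
      refl c00 c11 c22 c01 c02 c12 x0 x1 x2

  φ-comb : ∀ q s r x y →
    φ q ((s ·ᵥ x) -ᵥ (r ·ᵥ y)) ≡ s * s * φ q x - s * r * Φ q x y + r * r * φ q y
  φ-comb (qform c00 c11 c22 c01 c02 c12) s r ⟨ x0 , x1 , x2 ⟩ ⟨ y0 , y1 , y2 ⟩ =
    solve 14 (λ c00 c11 c22 c01 c02 c12 s r x0 x1 x2 y0 y1 y2 →
      φ′ c00 c11 c22 c01 c02 c12 (s :* x0 :- r :* y0) (s :* x1 :- r :* y1) (s :* x2 :- r :* y2)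
      := s :* s :* φ′ c00 c11 c22 c01 c02 c12 x0 x1 x2
         :- s :* r :* Φ′ c00 c11 c22 c01 c02 c12 x0 x1 x2 y0 y1 y2
         :+ r :* r :* φ′ c00 c11 c22 c01 c02 c12 y0 y1 y2)
      refl c00 c11 c22 c01 c02 c12 s r x0 x1 x2 y0 y1 y2

  Φ-combˡ : ∀ q s r x y z →
    Φ q ((s ·ᵥ x) -ᵥ (r ·ᵥ y)) z ≡ s * Φ q x z - r * Φ q y z
  Φ-combˡ (qform c00 c11 c22 c01 c02 c12) s r ⟨ x0 , x1 , x2 ⟩ ⟨ y0 , y1 , y2 ⟩ ⟨ z0 , z1 , z2 ⟩ =
    solve 17 (λ c00 c11 c22 c01 c02 c12 s r x0 x1 x2 y0 y1 y2 z0 z1 z2 →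
      Φ′ c00 c11 c22 c01 c02 c12 (s :* x0 :- r :* y0) (s :* x1 :- r :* y1) (s :* x2 :- r :* y2)
         z0 z1 z2
      := s :* Φ′ c00 c11 c22 c01 c02 c12 x0 x1 x2 z0 z1 z2
         :- r :* Φ′ c00 c11 c22 c01 c02 c12 y0 y1 y2 z0 z1 z2)
      refl c00 c11 c22 c01 c02 c12 s r x0 x1 x2 y0 y1 y2 z0 z1 z2

  det3-combˡ : ∀ s r x y z → det3 ((s ·ᵥ x) -ᵥ (r ·ᵥ y)) x z ≡ - r * det3 x z y
  det3-combˡ s r ⟨ x0 , x1 , x2 ⟩ ⟨ y0 , y1 , y2 ⟩ ⟨ z0 , z1 , z2 ⟩ =
    solve 11 (λ s r x0 x1 x2 y0 y1 y2 z0 z1 z2 →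
      det3′ (s :* x0 :- r :* y0) (s :* x1 :- r :* y1) (s :* x2 :- r :* y2) x0 x1 x2 z0 z1 z2
      := :- r :* det3′ x0 x1 x2 z0 z1 z2 y0 y1 y2)
      refl s r x0 x1 x2 y0 y1 y2 z0 z1 z2

φ-ψ : ∀ q x y → φ q (ψ q x y) ≡ φ q x * φ q x * φ q y
φ-ψ q x y = trans (φ-comb q (Φ q x y) (φ q x) x y) (cancel (Φ q x y) (φ q x) (φ q y))
  where
  cancel : ∀ s r w → s * s * r - s * r * s + r * r * w ≡ r * r * w
  cancel = solve-∀

Φ-ψ-self : ∀ q x y → Φ q (ψ q x y) x ≡ φ q x * Φ q x y
Φ-ψ-self q x y = begin
  Φ q (ψ q x y) x                 ≡⟨ Φ-combˡ q (Φ q x y) (φ q x) x y x ⟩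
  s * Φ q x x - φ q x * Φ q y x   ≡⟨ cong₂ (λ u v → s * u - φ q x * v) (Φ-diag q x) (Φ-sym q y x) ⟩
  s * (φ q x + φ q x) - φ q x * s ≡⟨ cancel s (φ q x) ⟩
  φ q x * s                       ∎
  where
  open ≡-Reasoning
  s = Φ q x y
  cancel : ∀ s r → s * (r + r) - r * s ≡ r * s
  cancel = solve-∀

module _ (q : QForm) (a b c : V3) (ha : φ q a ≡ 1ℤ) (hb : φ q b ≡ 1ℤ) (hc : φ q c ≡ 1ℤ) where
  open ≡-Reasoning

  private
    y : ℕ → V3
    y = Y q a b c

    t : ℕ → ℤ
    t = T q a b c

  φ-Y : ∀ k → φ q (y k) ≡ 1ℤ
  φ-Y zero = ha
  φ-Y (suc zero) = hb
  φ-Y (suc (suc zero)) = hc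
  φ-Y (suc (suc (suc k))) =
    trans (φ-ψ q (y (suc (suc k))) (y k))
          (cong₂ (λ u v → u * u * v) (φ-Y (suc (suc k))) (φ-Y k))

  det3-Y : ∀ k → det3 (y (suc (suc k))) (y (suc k)) (y k) ≡ (-1ℤ ^ k) * det3 c b a
  det3-Y zero = sym (*-identityˡ (det3 c b a))
  det3-Y (suc k) = begin
    det3 (ψ q y₂ y₀) y₂ y₁          ≡⟨ det3-combˡ (Φ q y₂ y₀) (φ q y₂) y₂ y₀ y₁ ⟩
    - φ q y₂ * det3 y₂ y₁ y₀        ≡⟨ cong₂ (λ u v → - u * v) (φ-Y (suc (suc k))) (det3-Y k) ⟩
    -1ℤ * ((-1ℤ ^ k) * det3 c b a)  ≡⟨ sym (*-assoc -1ℤ (-1ℤ ^ k) (det3 c b a)) ⟩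
    (-1ℤ ^ suc k) * det3 c b a      ∎
    where
    y₀ = y k
    y₁ = y (suc k)
    y₂ = y (suc (suc k))

  t≡Φ : ∀ k → t (suc (suc k)) ≡ Φ q (y (suc (suc k))) (y k)
  t≡Φ k = begin
    Φ q (ψ q y₂ y₀) y₂     ≡⟨ Φ-ψ-self q y₂ y₀ ⟩
    φ q y₂ * Φ q y₂ y₀     ≡⟨ cong (_* Φ q y₂ y₀) (φ-Y (suc (suc k))) ⟩
    1ℤ * Φ q y₂ y₀         ≡⟨ *-identityˡ (Φ q y₂ y₀) ⟩
    Φ q y₂ y₀              ∎
    where
    y₀ = y k
    y₂ = y (suc (suc k))

  Y-step : ∀ k → y (suc (suc (suc k))) ≡ (t (suc (suc k)) ·ᵥ y (suc (suc k))) -ᵥ y k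
  Y-step k = cong₂ (λ s v → (s ·ᵥ y (suc (suc k))) -ᵥ v)
    (sym (t≡Φ k))
    (trans (cong (_·ᵥ y k) (φ-Y (suc (suc k)))) (·ᵥ-identityˡ (y k)))

  t-step : ∀ k → t (suc (suc (suc k))) ≡ t (suc (suc k)) * t (suc k) - t k
  t-step k = begin
    t (suc (suc (suc k)))                    ≡⟨ t≡Φ (suc k) ⟩
    Φ q (ψ q y₂ y₀) y₁                       ≡⟨ Φ-combˡ q (Φ q y₂ y₀) (φ q y₂) y₂ y₀ y₁ ⟩
    Φ q y₂ y₀ * Φ q y₂ y₁ - φ q y₂ * Φ q y₀ y₁
      ≡⟨ cong₂ (λ u v → u * Φ q y₂ y₁ - v * Φ q y₀ y₁) (sym (t≡Φ k)) (φ-Y (suc (suc k))) ⟩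
    t (suc (suc k)) * t (suc k) - 1ℤ * Φ q y₀ y₁
      ≡⟨ cong (λ v → t (suc (suc k)) * t (suc k) - v) (trans (*-identityˡ _) (Φ-sym q y₀ y₁)) ⟩
    t (suc (suc k)) * t (suc k) - t k        ∎
    where
    y₀ = y k
    y₁ = y (suc k)
    y₂ = y (suc (suc k))

lemma5p1 : (q : QForm) (a b c : V3) →
    φ q a ≡ 1ℤ → φ q b ≡ 1ℤ → φ q c ≡ 1ℤ →
    (k : ℕ) →
      (φ q (Y q a b c k) ≡ 1ℤ)
      × (det3 (Y q a b c (suc (suc k))) (Y q a b c (suc k)) (Y q a b c k)
           ≡ (-1ℤ ^ k) * det3 c b a)
      × (T q a b c (suc (suc k)) ≡ Φ q (Y q a b c (suc (suc k))) (Y q a b c k))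
      × (Y q a b c (suc (suc (suc k)))
           ≡ (T q a b c (suc (suc k)) ·ᵥ Y q a b c (suc (suc k))) -ᵥ Y q a b c k)
      × (T q a b c (suc (suc (suc k)))
           ≡ T q a b c (suc (suc k)) * T q a b c (suc k) - T q a b c k)
lemma5p1 q a b c ha hb hc k =
    φ-Y q a b c ha hb hc k
  , det3-Y q a b c ha hb hc k
  , t≡Φ q a b c ha hb hc k
  , Y-step q a b c ha hb hc k
  , t-step q a b c ha hb hc k
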